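{- Let $n\in\mathbb{N}$, $n\ge1$, and $\mathbf{x}=(x_1,\dots,x_n)\in\mathbb{N}^{n}$ with all $x_k\ge 1$. Let $$M=\prod_{k=1}^{n}\left(1+4^{n x_k}\right)\qquad\text{and}\qquad s=n\sum_{k=1}^{n}x_k .$$ Then the number of zero partitions of $\mathbf{x}$ (out of all $2^n$ partitions) is encoded as a binary number in the binary digits of $M$ starting at the $s$-th digit and ending at the $(s+n)$-th digit (digits indexed from the least significant, which has index $0$); that is, the number of zero partitions of $\mathbf{x}$ equals $\left\lfloor M/2^{s}\right\rfloor \bmod 2^{n}$.
   Context: A partition of $\mathbf{x}\in\mathbb{N}^n$ is a vector $\sigma\in\{ -1,1\}^n$; its size is $\langle\mathbf{x},\sigma\rangle=\sum_{k=1}^n\sigma_k x_k$; it is a zero partition if its size is $0$. -}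

module Defs where

open import Data.Nat using (ℕ; zero; suc; _+_; _*_; _^_)
open import Data.Integer as ℤ using (ℤ; +_)
open import Data.Sign using (Sign) renaming (+ to plus; - to minus)
open import Data.Vec using (Vec; []; _∷_)
open import Data.List using (List; []; _∷_; _++_; map; length; filter)
open import Relation.Binary.PropositionalEquality using (_≡_)

Partition : ℕ → Set
Partition n = Vec Sign n

signed : Sign → ℕ → ℤ
signed plus  m = + m
signed minus m = ℤ.- (+ m)

size : ∀ {n} → Vec ℕ n → Partition n → ℤ
size []       []       = + 0
size (x ∷ xs) (s ∷ ss) = signed s x ℤ.+ size xs ss

allPartitions : (n : ℕ) → List (Partition n)
allPartitions zero    = [] ∷ []
allPartitions (suc n) =
  map (plus ∷_) (allPartitions n) ++ map (minus ∷_) (allPartitions n)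

numZeroPartitions : ∀ {n} → Vec ℕ n → ℕ
numZeroPartitions {n} x =
  length (filter (λ σ → size x σ ℤ.≟ + 0) (allPartitions n))

prodM : (n : ℕ) → ∀ {m} → Vec ℕ m → ℕ
prodM n []       = 1
prodM n (x ∷ xs) = (1 + 4 ^ (n * x)) * prodM n xs

sumV : ∀ {m} → Vec ℕ m → ℕ
sumV []       = 0
sumV (x ∷ xs) = x + sumV xs

-- Expanding the product gives M = Σ_σ 4^(n P(σ)), where P(σ) and Q(σ) are the sums of the
-- entries with sign + and − (so P + Q = s and ⟨x, σ⟩ = P − Q). Relative to D = 2^s a summand is
-- at most D / 2^n when P < Q, exactly D when P = Q, and a multiple of 2^n D when P > Q. The
-- partition with all signs + has P > Q, so fewer than 2^n summands are not multiples of 2^n D: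
-- those below D sum to less than D, and the digits [s, s + n) count exactly those equal to D.
module Submission where

open import Defs
open import Data.Nat using (ℕ; _≤_; _*_; _^_; _/_; _%_)
open import Data.Nat.Properties using (m^n≢0)
open import Data.Vec using (Vec)
open import Data.Vec.Relation.Unary.All using (All)
open import Relation.Binary.PropositionalEquality using (_≡_)

open import Data.Nat using (zero; suc; _+_; _∸_; _<_; NonZero; s≤s; z≤n)
open import Data.Nat.Properties
  using ( +-assoc; +-comm; +-suc; +-identityʳ; *-suc; *-comm; *-distribˡ-+; *-distribʳ-+
        ; +-mono-≤; +-monoʳ-<; *-monoʳ-≤; *-monoˡ-<; *-cancelʳ-<; ^-monoʳ-≤; ^-distribˡ-+-*; ^-*-assoc
        ; m∸n+n≡m; ≤-trans; ≤-<-trans; m≤m+n; m≤n+m; m≤n⇒m≤1+n; n<1+n; <-irrefl; <-cmp; module ≤-Reasoning)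
open import Data.Nat.DivMod using (+-distrib-/-∣ʳ; m<n⇒m/n≡0; m*n/n≡m; [m+kn]%n≡m%n; m<n⇒m%n≡m)
open import Data.Nat.Divisibility using (_∣_; divides; divides-refl)
open import Data.Nat.ListAction using (sum)
open import Data.Nat.ListAction.Properties using (sum-++)
open import Data.Nat.Tactic.RingSolver using (solve-∀)
import Data.Integer as ℤ
open import Data.Integer.Properties renaming (+-assoc to ℤ-+-assoc) using (+-injective; pos-+; i-j≡0⇒i≡j; i≡j⇒i-j≡0)
import Data.Integer.Tactic.RingSolver as ℤ-Solver
open import Data.Sign using () renaming (+ to plus; - to minus)
open import Data.Vec using ([]; _∷_)
import Data.Vec.Relation.Unary.All as Vec-All
open import Data.List using ([]; _∷_; _++_; map; length; filter)
open import Data.List.Properties using (map-++; map-∘; map-cong; length-++; length-map; filter-accept; filter-reject)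
import Data.List.Relation.Unary.All as List-All
open import Data.Product using (∃; _,_)
open import Function using (_∘_)
open import Relation.Nullary using (¬_)
open import Relation.Unary using (Decidable)
open import Relation.Binary using (tri<; tri≈; tri>)
open import Relation.Binary.PropositionalEquality using (refl; sym; trans; cong; cong₂; subst; subst₂; _≢_; module ≡-Reasoning)

[r+[b+c*u]*d]/d%u≡b : ∀ r b c d u .{{_ : NonZero d}} .{{_ : NonZero u}} → r < d → b < u →
                      ((r + (b + c * u) * d) / d) % u ≡ b
[r+[b+c*u]*d]/d%u≡b r b c d u r<d b<u = begin
  ((r + (b + c * u) * d) / d) % u    ≡⟨ cong (_% u) (+-distrib-/-∣ʳ r (divides-refl (b + c * u))) ⟩
  (r / d + (b + c * u) * d / d) % u  ≡⟨ cong₂ (λ s t → (s + t) % u) (m<n⇒m/n≡0 r<d) (m*n/n≡m (b + c * u) d) ⟩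
  (b + c * u) % u                    ≡⟨ [m+kn]%n≡m%n b c u ⟩
  b % u                              ≡⟨ m<n⇒m%n≡m b<u ⟩
  b                                  ∎
  where open ≡-Reasoning

-- A sum of summands each at most d / u, exactly d, or a multiple of d u; bound counts the
-- summands of the first two kinds.
record DigitSplit (d u total digit bound : ℕ) : Set where
  field
    belowCount belowSum carry : ℕ
    count-bound    : belowCount + digit ≤ bound
    belowSum-bound : belowSum * u ≤ belowCount * d
    total-split    : total ≡ belowSum + (digit + carry * u) * d

module _ {d u : ℕ} where
  open DigitSplit

  split-empty : DigitSplit d u 0 0 0
  split-empty = record { belowCount = 0 ; belowSum = 0 ; carry = 0
                       ; count-bound = z≤n ; belowSum-bound = z≤n ; total-split = refl }

  split-below : ∀ {w t b k} → w * u ≤ d → DigitSplit d u t b k → DigitSplit d u (w + t) b (suc k)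
  split-below {w} {t} {b} w*u≤d s = record
    { belowCount     = suc (belowCount s)
    ; belowSum       = w + belowSum s
    ; carry          = carry s
    ; count-bound    = s≤s (count-bound s)
    ; belowSum-bound = subst (_≤ suc (belowCount s) * d) (sym (*-distribʳ-+ u w (belowSum s)))
                             (+-mono-≤ w*u≤d (belowSum-bound s))
    ; total-split    = trans (cong (w +_) (total-split s))
                             (sym (+-assoc w (belowSum s) ((b + carry s * u) * d)))
    }

  split-at : ∀ {t b k} → DigitSplit d u t b k → DigitSplit d u (d + t) (suc b) (suc k)
  split-at {t} {b} {k} s = record
    { belowCount     = belowCount s
    ; belowSum       = belowSum s
    ; carry          = carry s
    ; count-bound    = subst (_≤ suc k) (sym (+-suc (belowCount s) b)) (s≤s (count-bound s))
    ; belowSum-bound = belowSum-bound s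
    ; total-split    = trans (cong (d +_) (total-split s)) (regroup d u (belowSum s) (carry s) b)
    }
    where
    regroup : ∀ d u r c b → d + (r + (b + c * u) * d) ≡ r + (suc b + c * u) * d
    regroup = solve-∀

  split-above : ∀ {w t b k} → d * u ∣ w → DigitSplit d u t b k → DigitSplit d u (w + t) b k
  split-above {b = b} (divides c′ refl) s = record
    { belowCount     = belowCount s
    ; belowSum       = belowSum s
    ; carry          = c′ + carry s
    ; count-bound    = count-bound s
    ; belowSum-bound = belowSum-bound s
    ; total-split    = trans (cong (c′ * (d * u) +_) (total-split s)) (regroup d u (belowSum s) (carry s) c′ b)
    }
    where
    regroup : ∀ d u r c c′ b → c′ * (d * u) + (r + (b + c * u) * d) ≡ r + (b + (c′ + c) * u) * d
    regroup = solve-∀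

  split-weaken : ∀ {t b k} → DigitSplit d u t b k → DigitSplit d u t b (suc k)
  split-weaken s = record
    { belowCount     = belowCount s
    ; belowSum       = belowSum s
    ; carry          = carry s
    ; count-bound    = m≤n⇒m≤1+n (count-bound s)
    ; belowSum-bound = belowSum-bound s
    ; total-split    = total-split s
    }

  split-digit : ∀ {t b k} .{{_ : NonZero d}} .{{_ : NonZero u}} →
                DigitSplit d u t b k → k < u → (t / d) % u ≡ b
  split-digit {t} {b} s k<u = begin
    (t / d) % u                                     ≡⟨ cong (λ t → (t / d) % u) (total-split s) ⟩
    ((belowSum s + (b + carry s * u) * d) / d) % u  ≡⟨ [r+[b+c*u]*d]/d%u≡b _ b (carry s) d u belowSum<d b<u ⟩
    b                                               ∎
    where
    open ≡-Reasoning
    b<u : b < u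
    b<u = ≤-<-trans (≤-trans (m≤n+m b (belowCount s)) (count-bound s)) k<u
    belowCount<u : belowCount s < u
    belowCount<u = ≤-<-trans (≤-trans (m≤m+n (belowCount s) b) (count-bound s)) k<u
    belowSum<d : belowSum s < d
    belowSum<d = *-cancelʳ-< u (belowSum s) d
      (≤-<-trans (belowSum-bound s) (subst (belowCount s * d <_) (*-comm u d) (*-monoˡ-< d belowCount<u)))

module Placement {A : Set} {Z : A → Set} (Z? : Decidable Z) (w : A → ℕ) (d u : ℕ) where

  data Placed (a : A) : Set where
    below : w a * u ≤ d → ¬ Z a → Placed a
    at    : w a ≡ d → Z a → Placed a
    above : d * u ∣ w a → ¬ Z a → Placed a

  sum-split : ∀ as → List-All.All Placed as →
              DigitSplit d u (sum (map w as)) (length (filter Z? as)) (length as)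
  sum-split [] List-All.[] = split-empty
  sum-split (a ∷ as) (below w*u≤d ¬z List-All.∷ ps)
    rewrite filter-reject Z? {a} {as} ¬z = split-below w*u≤d (sum-split as ps)
  sum-split (a ∷ as) (at refl z List-All.∷ ps)
    rewrite filter-accept Z? {a} {as} z = split-at (sum-split as ps)
  sum-split (a ∷ as) (above d*u∣w ¬z List-All.∷ ps)
    rewrite filter-reject Z? {a} {as} ¬z = split-weaken (split-above d*u∣w (sum-split as ps))

^-*-suc : ∀ m n k → m ^ (n * k) * m ^ n ≡ m ^ (n * suc k)
^-*-suc m n k = trans (sym (^-distribˡ-+-* m (n * k) n))
                      (cong (m ^_) (trans (+-comm (n * k) n) (sym (*-suc n k))))

^-monoʳ-∣ : ∀ m {i j} → i ≤ j → m ^ i ∣ m ^ j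
^-monoʳ-∣ m {i} {j} i≤j = divides (m ^ (j ∸ i))
  (trans (cong (m ^_) (sym (m∸n+n≡m i≤j))) (^-distribˡ-+-* m (j ∸ i) i))

4^[n*p]≡2^[n*[p+p]] : ∀ n p → 4 ^ (n * p) ≡ 2 ^ (n * (p + p))
4^[n*p]≡2^[n*[p+p]] n p = trans (^-*-assoc 2 2 (n * p)) (cong (2 ^_) (double n p))
  where
  double : ∀ n p → 2 * (n * p) ≡ n * (p + p)
  double = solve-∀

4^[n*p]*2^n≤2^[n*[p+q]] : ∀ n {p q} → p < q → 4 ^ (n * p) * 2 ^ n ≤ 2 ^ (n * (p + q))
4^[n*p]*2^n≤2^[n*[p+q]] n {p} {q} p<q = begin
  4 ^ (n * p) * 2 ^ n        ≡⟨ cong (_* 2 ^ n) (4^[n*p]≡2^[n*[p+p]] n p) ⟩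
  2 ^ (n * (p + p)) * 2 ^ n  ≡⟨ ^-*-suc 2 n (p + p) ⟩
  2 ^ (n * suc (p + p))      ≤⟨ ^-monoʳ-≤ 2 (*-monoʳ-≤ n (+-monoʳ-< p p<q)) ⟩
  2 ^ (n * (p + q))          ∎
  where open ≤-Reasoning

2^[n*[p+q]]*2^n∣4^[n*p] : ∀ n {p q} → q < p → 2 ^ (n * (p + q)) * 2 ^ n ∣ 4 ^ (n * p)
2^[n*[p+q]]*2^n∣4^[n*p] n {p} {q} q<p =
  subst₂ _∣_ (sym (^-*-suc 2 n (p + q))) (sym (4^[n*p]≡2^[n*[p+p]] n p))
         (^-monoʳ-∣ 2 (*-monoʳ-≤ n (+-monoʳ-< p q<p)))

plusSum : ∀ {m} → Vec ℕ m → Partition m → ℕ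
plusSum []       []            = 0
plusSum (x ∷ xs) (plus  ∷ σ)  = x + plusSum xs σ
plusSum (x ∷ xs) (minus ∷ σ)  = plusSum xs σ

minusSum : ∀ {m} → Vec ℕ m → Partition m → ℕ
minusSum []       []           = 0
minusSum (x ∷ xs) (plus  ∷ σ) = minusSum xs σ
minusSum (x ∷ xs) (minus ∷ σ) = x + minusSum xs σ

plusSum+minusSum≡sumV : ∀ {m} (x : Vec ℕ m) σ → plusSum x σ + minusSum x σ ≡ sumV x
plusSum+minusSum≡sumV []       []          = refl
plusSum+minusSum≡sumV (x ∷ xs) (plus ∷ σ)  =
  trans (+-assoc x _ _) (cong (x +_) (plusSum+minusSum≡sumV xs σ))
plusSum+minusSum≡sumV (x ∷ xs) (minus ∷ σ) =
  trans (swap (plusSum xs σ) x (minusSum xs σ)) (cong (x +_) (plusSum+minusSum≡sumV xs σ))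
  where
  swap : ∀ p x q → p + (x + q) ≡ x + (p + q)
  swap = solve-∀

size≡plusSum-minusSum : ∀ {m} (x : Vec ℕ m) σ → size x σ ≡ ℤ.+ plusSum x σ ℤ.- ℤ.+ minusSum x σ
size≡plusSum-minusSum []       []          = refl
size≡plusSum-minusSum (x ∷ xs) (plus ∷ σ)  = begin
  ℤ.+ x ℤ.+ size xs σ
    ≡⟨ cong (ℤ._+_ (ℤ.+ x)) (size≡plusSum-minusSum xs σ) ⟩
  ℤ.+ x ℤ.+ (ℤ.+ plusSum xs σ ℤ.- ℤ.+ minusSum xs σ)
    ≡⟨ ℤ-+-assoc (ℤ.+ x) (ℤ.+ plusSum xs σ) (ℤ.- ℤ.+ minusSum xs σ) ⟨
  (ℤ.+ x ℤ.+ ℤ.+ plusSum xs σ) ℤ.- ℤ.+ minusSum xs σ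
    ≡⟨ cong (ℤ._- ℤ.+ minusSum xs σ) (pos-+ x (plusSum xs σ)) ⟨
  ℤ.+ (x + plusSum xs σ) ℤ.- ℤ.+ minusSum xs σ
    ∎
  where open ≡-Reasoning
size≡plusSum-minusSum (x ∷ xs) (minus ∷ σ) = begin
  ℤ.- ℤ.+ x ℤ.+ size xs σ
    ≡⟨ cong (ℤ._+_ (ℤ.- ℤ.+ x)) (size≡plusSum-minusSum xs σ) ⟩
  ℤ.- ℤ.+ x ℤ.+ (ℤ.+ plusSum xs σ ℤ.- ℤ.+ minusSum xs σ)
    ≡⟨ regroup (ℤ.+ x) (ℤ.+ plusSum xs σ) (ℤ.+ minusSum xs σ) ⟩
  ℤ.+ plusSum xs σ ℤ.- (ℤ.+ x ℤ.+ ℤ.+ minusSum xs σ)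
    ≡⟨ cong (ℤ._-_ (ℤ.+ plusSum xs σ)) (pos-+ x (minusSum xs σ)) ⟨
  ℤ.+ plusSum xs σ ℤ.- ℤ.+ (x + minusSum xs σ)
    ∎
  where
  open ≡-Reasoning
  regroup : ∀ a p q → ℤ.- a ℤ.+ (p ℤ.- q) ≡ p ℤ.- (a ℤ.+ q)
  regroup = ℤ-Solver.solve-∀

size≡0⇒plusSum≡minusSum : ∀ {m} (x : Vec ℕ m) σ → size x σ ≡ ℤ.+ 0 → plusSum x σ ≡ minusSum x σ
size≡0⇒plusSum≡minusSum x σ size≡0 =
  +-injective (i-j≡0⇒i≡j _ _ (trans (sym (size≡plusSum-minusSum x σ)) size≡0))

plusSum≡minusSum⇒size≡0 : ∀ {m} (x : Vec ℕ m) σ → plusSum x σ ≡ minusSum x σ → size x σ ≡ ℤ.+ 0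
plusSum≡minusSum⇒size≡0 x σ p≡q = trans (size≡plusSum-minusSum x σ) (i≡j⇒i-j≡0 (cong ℤ.+_ p≡q))

allPlus : ∀ m → Partition m
allPlus zero    = []
allPlus (suc m) = plus ∷ allPlus m

plusSum-allPlus : ∀ {m} (x : Vec ℕ m) → plusSum x (allPlus m) ≡ sumV x
plusSum-allPlus []       = refl
plusSum-allPlus (x ∷ xs) = cong (x +_) (plusSum-allPlus xs)

minusSum-allPlus : ∀ {m} (x : Vec ℕ m) → minusSum x (allPlus m) ≡ 0
minusSum-allPlus []       = refl
minusSum-allPlus (x ∷ xs) = minusSum-allPlus xs

allPartitions-head : ∀ m → ∃ λ rest → allPartitions m ≡ allPlus m ∷ rest
allPartitions-head zero = [] , refl
allPartitions-head (suc m) with allPartitions-head m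
... | rest , eq rewrite eq = _ , refl

length-allPartitions : ∀ m → length (allPartitions m) ≡ 2 ^ m
length-allPartitions zero    = refl
length-allPartitions (suc m) = begin
  length (map (plus ∷_) σs ++ map (minus ∷_) σs)        ≡⟨ length-++ (map (plus ∷_) σs) ⟩
  length (map (plus ∷_) σs) + length (map (minus ∷_) σs) ≡⟨ cong₂ _+_ (length-map _ σs) (length-map _ σs) ⟩
  length σs + length σs                                  ≡⟨ cong (λ k → k + k) (length-allPartitions m) ⟩
  2 ^ m + 2 ^ m                                          ≡⟨ cong (2 ^ m +_) (+-identityʳ (2 ^ m)) ⟨
  2 ^ suc m                                              ∎
  where
  open ≡-Reasoning
  σs = allPartitions m

weight : (n : ℕ) → ∀ {m} → Vec ℕ m → Partition m → ℕ
weight n x σ = 4 ^ (n * plusSum x σ)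

sum-map-* : ∀ {A : Set} c (f : A → ℕ) as → sum (map (λ a → c * f a) as) ≡ c * sum (map f as)
sum-map-* c f []       = sym (*-comm c 0)
sum-map-* c f (a ∷ as) = trans (cong (c * f a +_) (sum-map-* c f as)) (sym (*-distribˡ-+ c (f a) _))

prodM≡sum-weight : ∀ n {m} (x : Vec ℕ m) → prodM n x ≡ sum (map (weight n x) (allPartitions m))
prodM≡sum-weight n []               = cong (λ k → 4 ^ k + 0) (sym (*-comm n 0))
prodM≡sum-weight n {suc m} (x ∷ xs) = begin
  (1 + c) * prodM n xs                                         ≡⟨ cong ((1 + c) *_) (prodM≡sum-weight n xs) ⟩
  S + c * S                                                    ≡⟨ +-comm S (c * S) ⟩
  c * S + S                                                    ≡⟨ cong (_+ S) (sum-map-* c (weight n xs) σs) ⟨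
  sum (map (λ σ → c * weight n xs σ) σs) + S                   ≡⟨ cong₂ _+_ (cong sum plus-part) (cong sum (map-∘ σs)) ⟩
  sum (map w (map (plus ∷_) σs)) + sum (map w (map (minus ∷_) σs))
                                                               ≡⟨ sum-++ (map w (map (plus ∷_) σs)) _ ⟨
  sum (map w (map (plus ∷_) σs) ++ map w (map (minus ∷_) σs))  ≡⟨ cong sum (map-++ w (map (plus ∷_) σs) _) ⟨
  sum (map w (allPartitions (suc m)))                          ∎
  where
  open ≡-Reasoning
  c  = 4 ^ (n * x)
  σs = allPartitions m
  S  = sum (map (weight n xs) σs)
  w  = weight n (x ∷ xs)
  weight-plus : ∀ σ → c * weight n xs σ ≡ w (plus ∷ σ)
  weight-plus σ = sym (trans (cong (4 ^_) (*-distribˡ-+ n x (plusSum xs σ))) (^-distribˡ-+-* 4 (n * x) _))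
  plus-part : map (λ σ → c * weight n xs σ) σs ≡ map w (map (plus ∷_) σs)
  plus-part = trans (map-cong weight-plus σs) (map-∘ σs)

module Digits (n : ℕ) {m : ℕ} (x : Vec ℕ m) where
  open Placement (λ σ → size x σ ℤ.≟ ℤ.+ 0) (weight n x) (2 ^ (n * sumV x)) (2 ^ n) public

  subst-sumV : ∀ σ (P : ℕ → Set) → P (plusSum x σ + minusSum x σ) → P (sumV x)
  subst-sumV σ P = subst P (plusSum+minusSum≡sumV x σ)

  placed : ∀ σ → Placed σ
  placed σ with <-cmp (plusSum x σ) (minusSum x σ)
  ... | tri< p<q _ _ = below (subst-sumV σ (λ k → weight n x σ * 2 ^ n ≤ 2 ^ (n * k)) (4^[n*p]*2^n≤2^[n*[p+q]] n p<q))
                             (λ z → <-irrefl (size≡0⇒plusSum≡minusSum x σ z) p<q)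
  ... | tri≈ _ p≡q _ = at (subst-sumV σ (λ k → weight n x σ ≡ 2 ^ (n * k))
                                     (trans (4^[n*p]≡2^[n*[p+p]] n _) (cong (λ q → 2 ^ (n * (plusSum x σ + q))) p≡q)))
                          (plusSum≡minusSum⇒size≡0 x σ p≡q)
  ... | tri> _ _ q<p = above (subst-sumV σ (λ k → 2 ^ (n * k) * 2 ^ n ∣ weight n x σ) (2^[n*[p+q]]*2^n∣4^[n*p] n q<p))
                             (λ z → <-irrefl (sym (size≡0⇒plusSum≡minusSum x σ z)) q<p)

  module _ (0<sumV : 0 < sumV x) where

    minusSum<plusSum-allPlus : minusSum x (allPlus m) < plusSum x (allPlus m)
    minusSum<plusSum-allPlus = subst₂ _<_ (sym (minusSum-allPlus x)) (sym (plusSum-allPlus x)) 0<sumV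

    allPlus-above : 2 ^ (n * sumV x) * 2 ^ n ∣ weight n x (allPlus m)
    allPlus-above = subst-sumV (allPlus m) (λ k → 2 ^ (n * k) * 2 ^ n ∣ weight n x (allPlus m))
                            (2^[n*[p+q]]*2^n∣4^[n*p] n minusSum<plusSum-allPlus)

    allPlus-nonzero : size x (allPlus m) ≢ ℤ.+ 0
    allPlus-nonzero z = <-irrefl (sym (size≡0⇒plusSum≡minusSum x (allPlus m) z)) minusSum<plusSum-allPlus

0<sumV : ∀ {k} (x : Vec ℕ (suc k)) → All (1 ≤_) x → 0 < sumV x
0<sumV (x ∷ xs) (1≤x Vec-All.∷ _) = ≤-trans 1≤x (m≤m+n x (sumV xs))

theorem4p1 : (n : ℕ) → 1 ≤ n → (x : Vec ℕ n) → All (1 ≤_) x →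
    numZeroPartitions x
      ≡ ((prodM n x / 2 ^ (n * sumV x)) {{m^n≢0 2 (n * sumV x)}} % 2 ^ n) {{m^n≢0 2 n}}
theorem4p1 zero     ()
theorem4p1 n@(suc _) _ x positive with allPartitions-head n
... | rest , all≡allPlus∷rest = begin
  numZeroPartitions x                          ≡⟨ cong (length ∘ filter Z?) all≡allPlus∷rest ⟩
  length (filter Z? (allPlus n ∷ rest))        ≡⟨ cong length (filter-reject Z? (allPlus-nonzero 0<S)) ⟩
  length (filter Z? rest)                      ≡⟨ split-digit split length-rest<u ⟨
  ((w (allPlus n) + sum (map w rest)) / D) % u ≡⟨ cong (λ t → (t / D) % u) M≡ ⟨
  (prodM n x / D) % u                          ∎
  where
  open ≡-Reasoning
  open Digits n x
  Z? : Decidable (λ σ → size x σ ≡ ℤ.+ 0)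
  Z? σ = size x σ ℤ.≟ ℤ.+ 0
  w : Partition n → ℕ
  w = weight n x
  D u : ℕ
  D = 2 ^ (n * sumV x)
  u = 2 ^ n
  instance
    D≢0 : NonZero D
    D≢0 = m^n≢0 2 (n * sumV x)
    u≢0 : NonZero u
    u≢0 = m^n≢0 2 n
  0<S : 0 < sumV x
  0<S = 0<sumV x positive
  split : DigitSplit D u (w (allPlus n) + sum (map w rest)) (length (filter Z? rest)) (length rest)
  split = split-above (allPlus-above 0<S) (sum-split rest (List-All.universal placed rest))
  length-rest<u : length rest < u
  length-rest<u = subst (length rest <_) (trans (cong length (sym all≡allPlus∷rest)) (length-allPartitions n))
                        (n<1+n (length rest))
  M≡ : prodM n x ≡ w (allPlus n) + sum (map w rest)
  M≡ = trans (prodM≡sum-weight n x) (cong (sum ∘ map w) all≡allPlus∷rest)
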